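{- Let $D$ be a strongly connected digraph and let $T$ be a DFS tree of $D$ rooted at $r$ of length $t\geq 1$, with generations $V_0,\ldots,V_t$. Let $G^D$ be the undirected graph with vertex set $\{V_0,\ldots,V_t\}$ in which, for $i>j$, $V_iV_j$ is an edge if and only if there is a backward arc $(u,v)$ of $D$ with $u\in V_i$ and $v\in V_j$. If $c'\colon\{V_0,\ldots,V_t\}\to\{1,\ldots,\chi(G^D)\}$ is a proper coloring of $G^D$, then the map $c\colon V(D)\to\{1,\ldots,\chi(G^D)\}$ defined by $c(v)=c'(V_i)$ for $v\in V_i$ is an acyclic coloring of $D$. Moreover, $\chi_A(D)\leq\chi(G^D)$.
   Context: All digraphs are finite and loopless. A digraph is strongly connected if there is a directed path between any ordered pair of distinct vertices. A DFS tree $T$ of $D$ rooted at $r$ is the spanning out-branching produced by depth-first search on $D$ from $r$. $v$ is a descendant of $u$ if there is a directed $uv$-path in $T$. An arc $(u,v)$ of $D$ is a backward arc (relative to $T$) if $u$ is a descendant of $v$. For a vertex $u$, $P_u$ denotes the unique directed path in $T$ from $r$ to $u$, and $l(P_u)$ its length (number of arcs). The length $t$ of $T$ is the maximum of $l(P_u)$ over all vertices $u$, and the $i$-th generation is $V_i=\{u\in V(D): l(P_u)=i\}$. An acyclic coloring is a vertex coloring in which each color class induces a subdigraph with no directed cycle; $\chi_A(D)$ is the minimum number of colors of an acyclic coloring of $D$. -}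

module Defs where

open import Level using (0ℓ)
open import Data.Nat using (ℕ; zero; suc; _<_; _≤_)
open import Data.Fin using (Fin)
open import Data.Product using (_×_; _,_; ∃; ∃-syntax; Σ)
open import Data.Sum using (_⊎_)
open import Data.List using (List; []; _∷_; _++_; [_]; length)
open import Data.List.Membership.Propositional using (_∈_; _∉_)
open import Data.List.Relation.Unary.All using (All)
open import Data.List.Relation.Unary.Unique.Propositional using (Unique)
open import Relation.Binary.PropositionalEquality using (_≡_; _≢_)
open import Relation.Binary.Construct.Closure.ReflexiveTransitive using (Star)
open import Relation.Nullary using (¬_)

Arcs : ℕ → Set₁
Arcs n = Fin n → Fin n → Set

Loopless : ∀ {n} → Arcs n → Set
Loopless {n} A = (v : Fin n) → ¬ A v v

StronglyConnected : ∀ {n} → Arcs n → Set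
StronglyConnected {n} A = (u v : Fin n) → u ≢ v → Star A u v

data Chain {n} (A : Arcs n) : List (Fin n) → Set where
  nil  : Chain A []
  one  : ∀ x → Chain A [ x ]
  cons : ∀ {x y} {zs} → A x y → Chain A (y ∷ zs) → Chain A (x ∷ y ∷ zs)

DirCycle : ∀ {n} → Arcs n → Fin n → List (Fin n) → Set
DirCycle A x xs = (1 ≤ length xs) × Unique (x ∷ xs) × Chain A (x ∷ xs ++ [ x ])

IsAcyclicColoring : ∀ {n k} → Arcs n → (Fin n → Fin k) → Set
IsAcyclicColoring A c =
  ∀ x xs → DirCycle A x xs → ¬ All (λ v → c v ≡ c x) xs

IsAcyclicChromaticNumber : ∀ {n} → Arcs n → ℕ → Set
IsAcyclicChromaticNumber {n} A k =
  (Σ (Fin n → Fin k) λ c → IsAcyclicColoring A c) ×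
  (∀ k′ → k′ < k → ¬ Σ (Fin n → Fin k′) λ c → IsAcyclicColoring A c)

-- undirected graphs on Fin m via a (symmetric) edge relation
IsProperColoring : ∀ {m k} → (Fin m → Fin m → Set) → (Fin m → Fin k) → Set
IsProperColoring {m} E c = (i j : Fin m) → E i j → c i ≢ c j

IsChromaticNumber : ∀ {m} → (Fin m → Fin m → Set) → ℕ → Set
IsChromaticNumber {m} E k =
  (Σ (Fin m → Fin k) λ c → IsProperColoring E c) ×
  (∀ k′ → k′ < k → ¬ Σ (Fin m → Fin k′) λ c → IsProperColoring E c)

-- Depth-first search as a (nondeterministic) inductive relation.
-- Explore A u S E S' : continuing the DFS at the current vertex u with
-- visited list S, the remaining exploration from u yields tree arcs E and
-- visited list S'.
data Explore {n} (A : Arcs n) :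
    Fin n → List (Fin n) → List (Fin n × Fin n) → List (Fin n) → Set where
  done : ∀ {u S} → (∀ w → A u w → w ∈ S) → Explore A u S [] S
  step : ∀ {u w S E₁ S₁ E₂ S₂} → A u w → w ∉ S →
         Explore A w (w ∷ S) E₁ S₁ → Explore A u S₁ E₂ S₂ →
         Explore A u S ((u , w) ∷ E₁ ++ E₂) S₂

IsDFSTree : ∀ {n} → Arcs n → Fin n → List (Fin n × Fin n) → Set
IsDFSTree A r E = ∃[ S ] Explore A r [ r ] E S

TreeArc : ∀ {n} → List (Fin n × Fin n) → Arcs n
TreeArc E u v = (u , v) ∈ E

Descendant : ∀ {n} → List (Fin n × Fin n) → Fin n → Fin n → Set
Descendant E v u = Star (TreeArc E) u v

data TPath {n} (E : List (Fin n × Fin n)) : Fin n → Fin n → ℕ → Set where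
  here  : ∀ {u} → TPath E u u zero
  there : ∀ {u v w k} → TreeArc E u v → TPath E v w k → TPath E u w (suc k)

InGeneration : ∀ {n} → List (Fin n × Fin n) → Fin n → Fin n → ℕ → Set
InGeneration E r v i = TPath E r v i

HasLength : ∀ {n} → List (Fin n × Fin n) → Fin n → ℕ → Set
HasLength {n} E r t =
  (∀ (u : Fin n) i → InGeneration E r u i → i ≤ t) × (∃[ u ] InGeneration E r u t)

BackwardArc : ∀ {n} → Arcs n → List (Fin n × Fin n) → Fin n → Fin n → Set
BackwardArc A E u v = A u v × Descendant E u v

BackFromTo : ∀ {n} → Arcs n → List (Fin n × Fin n) → Fin n → ℕ → ℕ → Set
BackFromTo A E r i j =
  j < i × ∃[ u ] ∃[ v ] (InGeneration E r u i × InGeneration E r v j × BackwardArc A E u v)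

GD : ∀ {n} → Arcs n → List (Fin n × Fin n) → Fin n → (t : ℕ) →
     Fin (suc t) → Fin (suc t) → Set
GD A E r t i j =
  BackFromTo A E r (Data.Fin.toℕ i) (Data.Fin.toℕ j) ⊎
  BackFromTo A E r (Data.Fin.toℕ j) (Data.Fin.toℕ i)

-- Order the vertices by the time depth-first search finishes them.  Every arc
-- of D is either backward or goes from a vertex to one finished earlier.  A
-- backward arc (u , v) joins generations i > j, so V_i V_j is an edge of G^D and
-- u, v get different colours.  Hence inside a colour class every arc strictly
-- decreases the finishing time, and no class contains a directed cycle.  As
-- every vertex lies in exactly one generation, a χ(G^D)-colouring of G^D lifts
-- to an acyclic colouring of D, so χ_A(D) ≤ χ(G^D).
module Submission where

open import Defs
open import Data.Nat using (ℕ; zero; suc; _+_; _≤_; _<_; z≤n; s≤s)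
open import Data.Nat.Properties
  using (≮⇒≥; <-irrefl; <-trans; m<m+n; +-monoʳ-<; +-identityʳ)
open import Data.Fin using (Fin; toℕ; fromℕ<)
open import Data.Fin.Properties using (toℕ-fromℕ<; toℕ-injective) renaming (_≟_ to _≟ᶠ_)
open import Data.Product using (_×_; _,_; proj₁; proj₂; ∃-syntax)
open import Data.Sum using (_⊎_; inj₁; inj₂)
open import Data.Empty using (⊥; ⊥-elim)
open import Data.List using (List; []; _∷_; _++_; [_]; length)
open import Data.List.Membership.Propositional using (_∈_; _∉_)
open import Data.List.Membership.Propositional.Properties using (∈-++⁺ˡ; ∈-++⁺ʳ; ∈-++⁻)
open import Data.List.Relation.Unary.Any using (here; there)
open import Data.List.Relation.Unary.All using (All; []; _∷_)
open import Data.List.Relation.Unary.All.Properties using (∷ʳ⁺; ∷ʳ⁻)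
open import Data.List.Relation.Binary.Subset.Propositional using (_⊆_)
open import Relation.Binary.PropositionalEquality
  using (_≡_; _≢_; refl; sym; trans; cong; subst; subst₂; module ≡-Reasoning)
open import Relation.Binary.Construct.Closure.ReflexiveTransitive using (Star; ε; _◅_)
import Relation.Binary.Construct.Closure.ReflexiveTransitive as Star
open import Relation.Nullary using (¬_; yes; no)
import Data.List.Relation.Unary.All as All

module _ {n : ℕ} where

  position : List (Fin n) → Fin n → ℕ
  position []       v = 0
  position (x ∷ xs) v with x ≟ᶠ v
  ... | yes _ = 0
  ... | no  _ = suc (position xs v)

  position-head : ∀ v xs → position (v ∷ xs) v ≡ 0
  position-head v xs with v ≟ᶠ v
  ... | yes _  = refl
  ... | no v≢v = ⊥-elim (v≢v refl)

  position-tail : ∀ {w v} xs → w ≢ v → position (w ∷ xs) v ≡ suc (position xs v)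
  position-tail {w} {v} xs w≢v with w ≟ᶠ v
  ... | yes w≡v = ⊥-elim (w≢v w≡v)
  ... | no  _   = refl

  position<length : ∀ {v} xs → v ∈ xs → position xs v < length xs
  position<length {v} (x ∷ xs) v∈ with x ≟ᶠ v
  position<length (x ∷ xs) v∈          | yes _   = s≤s z≤n
  position<length (x ∷ xs) (here refl) | no  x≢v = ⊥-elim (x≢v refl)
  position<length (x ∷ xs) (there v∈)  | no  _   = s≤s (position<length xs v∈)

  position-++ˡ : ∀ {v} xs ys → v ∈ xs → position (xs ++ ys) v ≡ position xs v
  position-++ˡ {v} (x ∷ xs) ys v∈ with x ≟ᶠ v
  position-++ˡ (x ∷ xs) ys v∈          | yes _   = refl
  position-++ˡ (x ∷ xs) ys (here refl) | no  x≢v = ⊥-elim (x≢v refl)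
  position-++ˡ (x ∷ xs) ys (there v∈)  | no  _   = cong suc (position-++ˡ xs ys v∈)

  position-++ʳ : ∀ {v} xs ys → v ∉ xs → position (xs ++ ys) v ≡ length xs + position ys v
  position-++ʳ     []       ys v∉ = refl
  position-++ʳ {v} (x ∷ xs) ys v∉ with x ≟ᶠ v
  ... | yes refl = ⊥-elim (v∉ (here refl))
  ... | no  _    = cong suc (position-++ʳ xs ys (λ v∈ → v∉ (there v∈)))

  position-++-∷ : ∀ {v} xs ys → v ∉ xs → position (xs ++ v ∷ ys) v ≡ length xs
  position-++-∷ {v} xs ys v∉ = begin
    position (xs ++ v ∷ ys) v       ≡⟨ position-++ʳ xs (v ∷ ys) v∉ ⟩
    length xs + position (v ∷ ys) v ≡⟨ cong (length xs +_) (position-head v ys) ⟩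
    length xs + 0                   ≡⟨ +-identityʳ (length xs) ⟩
    length xs                       ∎
    where open ≡-Reasoning

acyclic-by-ranking : ∀ {n k} {A : Arcs n} {c : Fin n → Fin k} (f : Fin n → ℕ) →
                     (∀ {x y} → A x y → c x ≡ c y → f y < f x) → IsAcyclicColoring A c
acyclic-by-ranking {A = A} {c} f descends x xs (_ , _ , cycle) monochromatic =
  <-irrefl refl (proj₂ (∷ʳ⁻ (chain-descends cycle (refl ∷ ∷ʳ⁺ monochromatic refl))))
  where
  chain-descends : ∀ {colour y zs} → Chain A (y ∷ zs) → All (λ v → c v ≡ colour) (y ∷ zs) →
                   All (λ z → f z < f y) zs
  chain-descends (one _)         _                  = []
  chain-descends (cons yz chain) (cy ∷ cz ∷ colours) =
    let fz<fy = descends yz (trans cy (sym cz))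
    in fz<fy ∷ All.map (λ lt → <-trans lt fz<fy) (chain-descends chain (cz ∷ colours))

module _ {n : ℕ} {E : List (Fin n × Fin n)} where

  descendant⇒path : ∀ {u v} → Descendant E v u → ∃[ k ] TPath E u v k
  descendant⇒path ε        = 0 , here
  descendant⇒path (e ◅ es) = let k , p = descendant⇒path es in suc k , there e p

  path-++ : ∀ {a b c i j} → TPath E a b i → TPath E b c j → TPath E a c (i + j)
  path-++ here        q = q
  path-++ (there e p) q = there e (path-++ p q)

  path-unsnoc : ∀ {a b k} → TPath E a b (suc k) → ∃[ v ] (TPath E a v k × TreeArc E v b)
  path-unsnoc (there e here)         = _ , here , e
  path-unsnoc (there e (there e′ p)) =
    let v , p′ , e″ = path-unsnoc (there e′ p) in v , there e p′ , e″

  path-length-unique : ∀ {r v} → (∀ {x} → ¬ TreeArc E x r) →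
                       (∀ {x x′ y} → TreeArc E x y → TreeArc E x′ y → x ≡ x′) →
                       ∀ {i j} → TPath E r v i → TPath E r v j → i ≡ j
  path-length-unique root parent {zero}  {zero}  here here = refl
  path-length-unique root parent {zero}  {suc j} here q    = ⊥-elim (root (proj₂ (proj₂ (path-unsnoc q))))
  path-length-unique root parent {suc i} {zero}  p    here = ⊥-elim (root (proj₂ (proj₂ (path-unsnoc p))))
  path-length-unique root parent {suc i} {suc j} p    q
    with path-unsnoc p | path-unsnoc q
  ... | x , p′ , e | x′ , q′ , e′ with parent e e′
  ... | refl = cong suc (path-length-unique root parent p′ q′)

module DFS {n : ℕ} (A : Arcs n) where

  finished : ∀ {u S E S′} → Explore A u S E S′ → List (Fin n)
  finished (done _)                 = []
  finished (step {w = w} _ _ e₁ e₂) = finished e₁ ++ w ∷ finished e₂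

  -- F lists, in finishing order, the vertices newly visited by a call started at
  -- u with visited list S.  The key field is new-out-classified: an arc that is
  -- not backward never leads to a vertex finished later.
  record Invariant (u : Fin n) (S : List (Fin n)) (E : List (Fin n × Fin n))
                   (S′ F : List (Fin n)) : Set where
    field
      visited-new-or-old : ∀ {x} → x ∈ S′ → x ∈ F ⊎ x ∈ S
      old-visited        : S ⊆ S′
      new-fresh          : ∀ {x} → x ∈ F → x ∉ S
      new-visited        : F ⊆ S′
      new-descendant     : ∀ {x} → x ∈ F → Descendant E x u
      out-visited        : ∀ {y} → A u y → y ∈ S′
      new-out-visited    : ∀ {x y} → x ∈ F → A x y → y ∈ S′
      new-out-classified : ∀ {x y} → x ∈ F → A x y →
                           Descendant E x y ⊎ (y ∈ F × position F y < position F x) ⊎ y ∈ S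
      tree-head-new      : ∀ {x y} → TreeArc E x y → y ∈ F
      tree-parent-unique : ∀ {x x′ y} → TreeArc E x y → TreeArc E x′ y → x ≡ x′

  invariant-done : ∀ {u S} → (∀ w → A u w → w ∈ S) → Invariant u S [] S []
  invariant-done out = record
    { visited-new-or-old = inj₂
    ; old-visited        = λ x∈ → x∈
    ; new-fresh          = λ ()
    ; new-visited        = λ ()
    ; new-descendant     = λ ()
    ; out-visited        = out _
    ; new-out-visited    = λ ()
    ; new-out-classified = λ ()
    ; tree-head-new      = λ ()
    ; tree-parent-unique = λ ()
    }

  module Step {u w S E₁ S₁ E₂ S₂ F₁ F₂} (w∉S : w ∉ S)
              (I₁ : Invariant w (w ∷ S) E₁ S₁ F₁) (I₂ : Invariant u S₁ E₂ S₂ F₂) where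

    private
      module I₁ = Invariant I₁
      module I₂ = Invariant I₂

    F : List (Fin n)
    F = F₁ ++ w ∷ F₂

    E : List (Fin n × Fin n)
    E = (u , w) ∷ E₁ ++ E₂

    Classified : Fin n → Fin n → Set
    Classified x y = Descendant E x y ⊎ (y ∈ F × position F y < position F x) ⊎ y ∈ S

    w∈S₁ : w ∈ S₁
    w∈S₁ = I₁.old-visited (here refl)

    w∉F₁ : w ∉ F₁
    w∉F₁ w∈ = I₁.new-fresh w∈ (here refl)

    S⊆S₁ : S ⊆ S₁
    S⊆S₁ x∈ = I₁.old-visited (there x∈)

    F₁⊆F : F₁ ⊆ F
    F₁⊆F = ∈-++⁺ˡ

    w∈F : w ∈ F
    w∈F = ∈-++⁺ʳ F₁ (here refl)

    F₂⊆F : F₂ ⊆ F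
    F₂⊆F x∈ = ∈-++⁺ʳ F₁ (there x∈)

    split : ∀ {x} → x ∈ F → x ∈ F₁ ⊎ x ≡ w ⊎ x ∈ F₂
    split x∈ with ∈-++⁻ F₁ x∈
    ... | inj₁ x∈F₁          = inj₁ x∈F₁
    ... | inj₂ (here x≡w)    = inj₂ (inj₁ x≡w)
    ... | inj₂ (there x∈F₂) = inj₂ (inj₂ x∈F₂)

    E₁⊆E : E₁ ⊆ E
    E₁⊆E e = there (∈-++⁺ˡ e)

    E₂⊆E : E₂ ⊆ E
    E₂⊆E e = there (∈-++⁺ʳ E₁ e)

    position-F₁ : ∀ {x} → x ∈ F₁ → position F x ≡ position F₁ x
    position-F₁ = position-++ˡ F₁ (w ∷ F₂)

    position-w : position F w ≡ length F₁
    position-w = position-++-∷ F₁ F₂ w∉F₁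

    position-F₂ : ∀ {x} → x ∈ F₂ → position F x ≡ length F₁ + suc (position F₂ x)
    position-F₂ {x} x∈ =
      trans (position-++ʳ F₁ (w ∷ F₂) (λ x∈F₁ → I₂.new-fresh x∈ (I₁.new-visited x∈F₁)))
            (cong (length F₁ +_) (position-tail F₂ (λ { refl → I₂.new-fresh x∈ w∈S₁ })))

    F₁-before-w : ∀ {x} → x ∈ F₁ → position F x < position F w
    F₁-before-w x∈ = subst₂ _<_ (sym (position-F₁ x∈)) (sym position-w)
                       (position<length F₁ x∈)

    w-before-F₂ : ∀ {x} → x ∈ F₂ → position F w < position F x
    w-before-F₂ x∈ = subst₂ _<_ (sym position-w) (sym (position-F₂ x∈))
                       (m<m+n (length F₁) (s≤s z≤n))

    classified-F₁ : ∀ {x y} → x ∈ F₁ → A x y → Classified x y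
    classified-F₁ x∈ xy with I₁.new-out-classified x∈ xy
    ... | inj₁ desc                  = inj₁ (Star.map E₁⊆E desc)
    ... | inj₂ (inj₁ (y∈ , y<x))     =
      inj₂ (inj₁ (F₁⊆F y∈ , subst₂ _<_ (sym (position-F₁ y∈)) (sym (position-F₁ x∈)) y<x))
    ... | inj₂ (inj₂ (here refl))    = inj₁ (Star.map E₁⊆E (I₁.new-descendant x∈))
    ... | inj₂ (inj₂ (there y∈S))    = inj₂ (inj₂ y∈S)

    classified-w : ∀ {y} → A w y → Classified w y
    classified-w wy with I₁.visited-new-or-old (I₁.out-visited wy)
    ... | inj₁ y∈             = inj₂ (inj₁ (F₁⊆F y∈ , F₁-before-w y∈))
    ... | inj₂ (here refl)    = inj₁ ε
    ... | inj₂ (there y∈S)    = inj₂ (inj₂ y∈S)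

    classified-F₂ : ∀ {x y} → x ∈ F₂ → A x y → Classified x y
    classified-F₂ x∈ xy with I₂.new-out-classified x∈ xy
    ... | inj₁ desc              = inj₁ (Star.map E₂⊆E desc)
    ... | inj₂ (inj₁ (y∈ , y<x)) =
      inj₂ (inj₁ (F₂⊆F y∈ , subst₂ _<_ (sym (position-F₂ y∈)) (sym (position-F₂ x∈))
                                          (+-monoʳ-< (length F₁) (s≤s y<x))))
    ... | inj₂ (inj₂ y∈S₁) with I₁.visited-new-or-old y∈S₁
    ...   | inj₁ y∈           = inj₂ (inj₁ (F₁⊆F y∈ , <-trans (F₁-before-w y∈) (w-before-F₂ x∈)))
    ...   | inj₂ (here refl)  = inj₂ (inj₁ (w∈F , w-before-F₂ x∈))
    ...   | inj₂ (there y∈S)  = inj₂ (inj₂ y∈S)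

    classified : ∀ {x y} → x ∈ F → A x y → Classified x y
    classified x∈ xy with split x∈
    ... | inj₁ x∈F₁        = classified-F₁ x∈F₁ xy
    ... | inj₂ (inj₁ refl) = classified-w xy
    ... | inj₂ (inj₂ x∈F₂) = classified-F₂ x∈F₂ xy

    visited-new-or-old : ∀ {x} → x ∈ S₂ → x ∈ F ⊎ x ∈ S
    visited-new-or-old x∈ with I₂.visited-new-or-old x∈
    ... | inj₁ x∈F₂ = inj₁ (F₂⊆F x∈F₂)
    ... | inj₂ x∈S₁ with I₁.visited-new-or-old x∈S₁
    ...   | inj₁ x∈F₁         = inj₁ (F₁⊆F x∈F₁)
    ...   | inj₂ (here refl)  = inj₁ w∈F
    ...   | inj₂ (there x∈S)  = inj₂ x∈S

    new-fresh : ∀ {x} → x ∈ F → x ∉ S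
    new-fresh x∈ x∈S with split x∈
    ... | inj₁ x∈F₁        = I₁.new-fresh x∈F₁ (there x∈S)
    ... | inj₂ (inj₁ refl) = w∉S x∈S
    ... | inj₂ (inj₂ x∈F₂) = I₂.new-fresh x∈F₂ (S⊆S₁ x∈S)

    new-visited : F ⊆ S₂
    new-visited x∈ with split x∈
    ... | inj₁ x∈F₁        = I₂.old-visited (I₁.new-visited x∈F₁)
    ... | inj₂ (inj₁ refl) = I₂.old-visited w∈S₁
    ... | inj₂ (inj₂ x∈F₂) = I₂.new-visited x∈F₂

    new-descendant : ∀ {x} → x ∈ F → Descendant E x u
    new-descendant x∈ with split x∈
    ... | inj₁ x∈F₁        = here refl ◅ Star.map E₁⊆E (I₁.new-descendant x∈F₁)
    ... | inj₂ (inj₁ refl) = here refl ◅ ε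
    ... | inj₂ (inj₂ x∈F₂) = Star.map E₂⊆E (I₂.new-descendant x∈F₂)

    new-out-visited : ∀ {x y} → x ∈ F → A x y → y ∈ S₂
    new-out-visited x∈ xy with split x∈
    ... | inj₁ x∈F₁        = I₂.old-visited (I₁.new-out-visited x∈F₁ xy)
    ... | inj₂ (inj₁ refl) = I₂.old-visited (I₁.out-visited xy)
    ... | inj₂ (inj₂ x∈F₂) = I₂.new-out-visited x∈F₂ xy

    tree-head-new : ∀ {x y} → TreeArc E x y → y ∈ F
    tree-head-new (here refl) = w∈F
    tree-head-new (there e) with ∈-++⁻ E₁ e
    ... | inj₁ e₁ = F₁⊆F (I₁.tree-head-new e₁)
    ... | inj₂ e₂ = F₂⊆F (I₂.tree-head-new e₂)

    w-not-tree-head : ∀ {x} → TreeArc (E₁ ++ E₂) x w → ⊥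
    w-not-tree-head e with ∈-++⁻ E₁ e
    ... | inj₁ e₁ = w∉F₁ (I₁.tree-head-new e₁)
    ... | inj₂ e₂ = I₂.new-fresh (I₂.tree-head-new e₂) w∈S₁

    tree-heads-disjoint : ∀ {x x′ y} → TreeArc E₁ x y → TreeArc E₂ x′ y → ⊥
    tree-heads-disjoint e₁ e₂ = I₂.new-fresh (I₂.tree-head-new e₂) (I₁.new-visited (I₁.tree-head-new e₁))

    tree-parent-unique : ∀ {x x′ y} → TreeArc E x y → TreeArc E x′ y → x ≡ x′
    tree-parent-unique (here refl) (here refl) = refl
    tree-parent-unique (here refl) (there e′)  = ⊥-elim (w-not-tree-head e′)
    tree-parent-unique (there e)   (here refl) = ⊥-elim (w-not-tree-head e)
    tree-parent-unique (there e)   (there e′) with ∈-++⁻ E₁ e | ∈-++⁻ E₁ e′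
    ... | inj₁ e₁ | inj₁ e₁′ = I₁.tree-parent-unique e₁ e₁′
    ... | inj₂ e₂ | inj₂ e₂′ = I₂.tree-parent-unique e₂ e₂′
    ... | inj₁ e₁ | inj₂ e₂′ = ⊥-elim (tree-heads-disjoint e₁ e₂′)
    ... | inj₂ e₂ | inj₁ e₁′ = ⊥-elim (tree-heads-disjoint e₁′ e₂)

    invariant : Invariant u S E S₂ F
    invariant = record
      { visited-new-or-old = visited-new-or-old
      ; old-visited        = λ x∈ → I₂.old-visited (S⊆S₁ x∈)
      ; new-fresh          = new-fresh
      ; new-visited        = new-visited
      ; new-descendant     = new-descendant
      ; out-visited        = I₂.out-visited
      ; new-out-visited    = new-out-visited
      ; new-out-classified = classified
      ; tree-head-new      = tree-head-new
      ; tree-parent-unique = tree-parent-unique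
      }

  invariant : ∀ {u S E S′} (ex : Explore A u S E S′) → Invariant u S E S′ (finished ex)
  invariant (done out)             = invariant-done out
  invariant (step _ w∉S ex₁ ex₂) = Step.invariant w∉S (invariant ex₁) (invariant ex₂)

module DFSTree {n : ℕ} {A : Arcs n} (strong : StronglyConnected A)
               {r : Fin n} {E : List (Fin n × Fin n)} {S : List (Fin n)}
               (ex : Explore A r [ r ] E S) where

  open DFS A
  open Invariant (invariant ex)

  postorder : List (Fin n)
  postorder = finished ex ++ [ r ]

  r∉finished : r ∉ finished ex
  r∉finished r∈ = new-fresh r∈ (here refl)

  r∈S : r ∈ S
  r∈S = old-visited (here refl)

  out-closed : ∀ {x y} → x ∈ S → A x y → y ∈ S
  out-closed x∈ xy with visited-new-or-old x∈
  ... | inj₁ x∈F         = new-out-visited x∈F xy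
  ... | inj₂ (here refl) = out-visited xy

  reachable-visited : ∀ {x y} → Star A x y → x ∈ S → y ∈ S
  reachable-visited ε        x∈ = x∈
  reachable-visited (a ◅ as) x∈ = reachable-visited as (out-closed x∈ a)

  visited : ∀ v → v ∈ S
  visited v with r ≟ᶠ v
  ... | yes refl = r∈S
  ... | no  r≢v  = reachable-visited (strong r v r≢v) r∈S

  descendant-of-root : ∀ v → Descendant E v r
  descendant-of-root v with visited-new-or-old (visited v)
  ... | inj₁ v∈F         = new-descendant v∈F
  ... | inj₂ (here refl) = ε

  position-postorder : ∀ {v} → v ∈ finished ex → position postorder v ≡ position (finished ex) v
  position-postorder = position-++ˡ (finished ex) [ r ]

  position-postorder-root : position postorder r ≡ length (finished ex)
  position-postorder-root = position-++-∷ (finished ex) [] r∉finished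

  arc-backward-or-descending : ∀ {x y} → A x y →
                               Descendant E x y ⊎ position postorder y < position postorder x
  arc-backward-or-descending {x} xy with visited-new-or-old (visited x)
  ... | inj₂ (here refl) with visited-new-or-old (out-visited xy)
  ...   | inj₁ y∈F         = inj₂ (subst₂ _<_ (sym (position-postorder y∈F)) (sym position-postorder-root)
                                           (position<length (finished ex) y∈F))
  ...   | inj₂ (here refl) = inj₁ ε
  arc-backward-or-descending {x} xy | inj₁ x∈F with new-out-classified x∈F xy
  ...   | inj₁ desc               = inj₁ desc
  ...   | inj₂ (inj₁ (y∈F , y<x)) =
    inj₂ (subst₂ _<_ (sym (position-postorder y∈F)) (sym (position-postorder x∈F)) y<x)
  ...   | inj₂ (inj₂ (here refl)) = inj₁ (descendant-of-root x)

  generation : ∀ v → ∃[ i ] InGeneration E r v i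
  generation v = descendant⇒path (descendant-of-root v)

  generation-unique : ∀ {v i j} → InGeneration E r v i → InGeneration E r v j → i ≡ j
  generation-unique = path-length-unique (λ e → r∉finished (tree-head-new e)) tree-parent-unique

  module Generations (t : ℕ) (bounded : ∀ u i → InGeneration E r u i → i ≤ t) where

    level : ∀ {v i} → InGeneration E r v i → Fin (suc t)
    level p = fromℕ< (s≤s (bounded _ _ p))

    toℕ-level : ∀ {v i} (p : InGeneration E r v i) → toℕ (level p) ≡ i
    toℕ-level p = toℕ-fromℕ< (s≤s (bounded _ _ p))

    at-level : ∀ {v i} (p : InGeneration E r v i) → InGeneration E r v (toℕ (level p))
    at-level p = subst (InGeneration E r _) (sym (toℕ-level p)) p

    lift : ∀ {k} → (Fin (suc t) → Fin k) → Fin n → Fin k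
    lift c′ v = c′ (level (proj₂ (generation v)))

    lift-respects : ∀ {k} (c′ : Fin (suc t) → Fin k) v (i : Fin (suc t)) →
                    InGeneration E r v (toℕ i) → lift c′ v ≡ c′ i
    lift-respects c′ v i p = cong c′ (toℕ-injective (trans (toℕ-level path) (generation-unique path p)))
      where path = proj₂ (generation v)

    module Colouring (loopless : Loopless A) {k : ℕ} (c′ : Fin (suc t) → Fin k)
                     (proper : IsProperColoring (GD A E r t) c′) (c : Fin n → Fin k)
                     (respects : ∀ v (i : Fin (suc t)) → InGeneration E r v (toℕ i) → c v ≡ c′ i)
                     where

      colour-level : ∀ {v i} (p : InGeneration E r v i) → c v ≡ c′ (level p)
      colour-level p = respects _ _ (at-level p)

      backward-arc-bichromatic : ∀ {x y} → BackwardArc A E x y → c x ≢ c y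
      backward-arc-bichromatic (xy , ε) _ = loopless _ xy
      backward-arc-bichromatic {x} {y} (xy , e ◅ es) cx≡cy =
        proper (level path-x) (level path-y) edge
               (trans (sym (colour-level path-x)) (trans cx≡cy (colour-level path-y)))
        where
        j = proj₁ (generation y)
        path-y = proj₂ (generation y)
        path-x = path-++ path-y (there e (proj₂ (descendant⇒path es)))
        edge : GD A E r t (level path-x) (level path-y)
        edge = inj₁ ( subst₂ _<_ (sym (toℕ-level path-y)) (sym (toℕ-level path-x)) (m<m+n j (s≤s z≤n))
                    , x , y , at-level path-x , at-level path-y , xy , e ◅ es )

      monochromatic-arc-descends : ∀ {x y} → A x y → c x ≡ c y →
                                   position postorder y < position postorder x
      monochromatic-arc-descends xy cx≡cy with arc-backward-or-descending xy
      ... | inj₁ desc = ⊥-elim (backward-arc-bichromatic (xy , desc) cx≡cy)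
      ... | inj₂ y<x  = y<x

      acyclic : IsAcyclicColoring A c
      acyclic = acyclic-by-ranking (position postorder) monochromatic-arc-descends

proposition3 : (n : ℕ) (A : Arcs n) → Loopless A → StronglyConnected A →
    (r : Fin n) (E : List (Fin n × Fin n)) → IsDFSTree A r E →
    (t : ℕ) → HasLength E r t → 1 ≤ t →
    (k : ℕ) → IsChromaticNumber (GD A E r t) k →
    ((c′ : Fin (suc t) → Fin k) → IsProperColoring (GD A E r t) c′ →
      (c : Fin n → Fin k) →
      (∀ v (i : Fin (suc t)) → InGeneration E r v (toℕ i) → c v ≡ c′ i) →
      IsAcyclicColoring A c)
    × (∀ a → IsAcyclicChromaticNumber A a → a ≤ k)
proposition3 n A loopless strong r E (S , ex) t (bounded , _) _ k ((c′ , proper) , _) =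
  Colouring.acyclic loopless , χA≤k
  where
  open DFSTree strong ex
  open Generations t bounded

  χA≤k : ∀ a → IsAcyclicChromaticNumber A a → a ≤ k
  χA≤k a (_ , minimal) = ≮⇒≥ λ k<a →
    minimal k k<a (lift c′ , Colouring.acyclic loopless c′ proper (lift c′) (lift-respects c′))
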